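{- Let $(W,S)$ be a finite Coxeter system and let $W^{LR}$ be the submonoid of $\mathrm{Or}(W)$ generated by $\{Q^IP^J: I,J\subseteq S\}$. Then the set of idempotents of $W^{LR}$ is exactly $\{Q^IP^J: I,J\subseteq S\}$.
   Context: $W$ is ordered by the Bruhat order; $\ell$ is the length function. $\mathrm{Or}(W)$ is the monoid under composition of order preserving regressive ($f(w)\leqslant w$) maps $W\to W$. For $J\subseteq S$, $W_J$ is the subgroup generated by $J$, and every $w\in W$ factors uniquely as $w=w^Jw_J$ with $w_J\in W_J$ and $w^J\in W^J:=\{w:\ell(ws)>\ell(w)\ \forall s\in J\}$, and uniquely as $w={}_Jw\,{}^Jw$ with ${}_Jw\in W_J$ and ${}^Jw\in{}^JW:=\{w:\ell(sw)>\ell(w)\ \forall s\in J\}$. $P^J:W\to W$ is $w\mapsto w^J$ and $Q^J:W\to W$ is $w\mapsto{}^Jw$; these lie in $\mathrm{Or}(W)$. -}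

module Defs where

open import Level using (0ℓ)
open import Data.Nat using (ℕ; zero; suc; _<_; _≤_)
open import Data.Fin using (Fin)
open import Data.Fin.Subset using (Subset; _∈_)
open import Data.List using (List; []; _∷_; length; foldr)
open import Data.List.Relation.Unary.All using (All)
import Data.List.Membership.Propositional as LMem
open import Data.Product using (Σ; ∃; _×_; _,_)
open import Relation.Binary.PropositionalEquality using (_≡_; _≢_)
open import Algebra.Structures using (IsGroup)
open import Algebra.Bundles using (Group)

pow : {A : Set} → (A → A → A) → A → A → ℕ → A
pow _∙_ ε x zero = ε
pow _∙_ ε x (suc n) = x ∙ pow _∙_ ε x n

-- A finite Coxeter system (W,S): W a finite group, S = {s i | i : Fin r}
-- a set of involutions such that W has the presentation
--   < S | (s s')^{m(s,s')} = 1 >,  m(s,s') = order of s s'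
-- (expressed by the universal property of the presentation).
record FiniteCoxeterSystem : Set₁ where
  field
    W     : Set
    _·_   : W → W → W
    e     : W
    _⁻¹   : W → W
    isGroup : IsGroup _≡_ _·_ e _⁻¹
    elems    : List W
    complete : ∀ w → LMem._∈_ w elems
    r     : ℕ
    s     : Fin r → W
    s-inj : ∀ i j → s i ≡ s j → i ≡ j
    s≢e   : ∀ i → s i ≢ e
    s²≡e  : ∀ i → s i · s i ≡ e
  eval : List (Fin r) → W
  eval = foldr (λ i w → s i · w) e
  field
    generates : ∀ w → ∃ λ (ws : List (Fin r)) → eval ws ≡ w
    m       : Fin r → Fin r → ℕ
    m-pos   : ∀ i j → 1 ≤ m i j
    m-rel   : ∀ i j → pow _·_ e (s i · s j) (m i j) ≡ e
    m-min   : ∀ i j k → 1 ≤ k → pow _·_ e (s i · s j) k ≡ e → m i j ≤ k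
    presentation :
      (G : Group 0ℓ 0ℓ) (g : Fin r → Group.Carrier G) →
      (∀ i j → Group._≈_ G (pow (Group._∙_ G) (Group.ε G) (Group._∙_ G (g i) (g j)) (m i j)) (Group.ε G)) →
      Σ (W → Group.Carrier G) λ φ →
        (∀ x y → Group._≈_ G (φ (x · y)) (Group._∙_ G (φ x) (φ y)))
        × (∀ i → Group._≈_ G (φ (s i)) (g i))

module _ (C : FiniteCoxeterSystem) where
  open FiniteCoxeterSystem C

  IsLengthFunction : (W → ℕ) → Set
  IsLengthFunction ℓ = ∀ w →
    (∃ λ ws → eval ws ≡ w × length ws ≡ ℓ w)
    × (∀ ws → eval ws ≡ w → ℓ w ≤ length ws)

  InParabolic : Subset r → W → Set
  InParabolic J w = ∃ λ ws → All (λ j → j ∈ J) ws × eval ws ≡ w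

  InMinRight : (W → ℕ) → Subset r → W → Set
  InMinRight ℓ J w = ∀ j → j ∈ J → ℓ w < ℓ (w · s j)

  InMinLeft : (W → ℕ) → Subset r → W → Set
  InMinLeft ℓ J w = ∀ j → j ∈ J → ℓ w < ℓ (s j · w)

  IsP : (W → ℕ) → (Subset r → W → W) → Set
  IsP ℓ P = ∀ J w → InMinRight ℓ J (P J w) × (∃ λ u → InParabolic J u × w ≡ P J w · u)

  IsQ : (W → ℕ) → (Subset r → W → W) → Set
  IsQ ℓ Q = ∀ J w → InMinLeft ℓ J (Q J w) × (∃ λ u → InParabolic J u × w ≡ u · Q J w)

-- the element of W^{LR} given by the composition Q^{I₁}P^{J₁} ∘ ... ∘ Q^{Iₖ}P^{Jₖ}
-- (empty list = identity)
composeQP : {W : Set} {r : ℕ} → (P Q : Subset r → W → W) → List (Subset r × Subset r) → W → W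
composeQP P Q [] w = w
composeQP P Q ((I , J) ∷ gs) w = Q I (P J (composeQP P Q gs w))

{-# OPTIONS --safe #-}

-- Each Q^I P^J moves w inside its double coset W_I w W_J without increasing its length, so a
-- composite f of such maps keeps w inside W_U w W_V, where U and V are the unions of the I's and
-- of the J's. If f is idempotent, then f w is fixed by f and hence, lengths never increasing, by
-- every factor: f w has no left descent in U and no right descent in V. Such an element is the
-- unique element of minimal length of its double coset, and so is Q^U P^V w; hence f = Q^U P^V.
-- Conversely Q^I P^J w is already minimal in W_I w W_J, so Q^I P^J is idempotent.
-- The Coxeter-theoretic input is the exchange condition, obtained from the presentation through
-- Tits' action of W on W × Bool, pairs of a reflection and a sign.

module Submission where

open import Defs
open import Level using (0ℓ)
open import Algebra.Bundles using (Group; Monoid)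
open import Algebra.Structures using (IsGroup)
import Algebra.Properties.Group as GroupProperties
open import Data.Bool using (Bool; true; false; not; _xor_)
open import Data.Bool.Properties using (xor-assoc; xor-same; xor-identityʳ; not-distribˡ-xor)
open import Data.Empty using (⊥-elim)
open import Data.Fin using (Fin)
open import Data.Fin.Properties using (any?)
open import Data.Fin.Subset using (Subset; _∈_; _∪_; _⊆_; ⊥)
open import Data.Fin.Subset.Properties using (_∈?_; x∈p∪q⁻; p⊆p∪q; q⊆p∪q; ∉⊥; ⊥⊆; ⊆-refl)
open import Data.List using (List; []; _∷_; _++_; _∷ʳ_; [_]; length; reverse; foldr; map)
open import Data.List.Properties using (length-++; length-reverse; unfold-reverse)
import Data.List.Membership.Propositional as Mem
open import Data.List.Relation.Binary.Permutation.Propositional using (↭-sym)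
open import Data.List.Relation.Binary.Permutation.Propositional.Properties using (All-resp-↭; ↭-reverse)
open import Data.List.Relation.Unary.All as All using (All; []; _∷_)
open import Data.List.Relation.Unary.All.Properties using (++⁺; ∷ʳ⁺; ∷ʳ⁻)
open import Data.List.Relation.Unary.Any using (here; there)
open import Data.List.Reverse using (Reverse; []; _∶_∶ʳ_; reverseView)
open import Data.Nat as ℕ using (ℕ; zero; suc; _+_; _≤_; _<_; z≤n; s≤s)
open import Data.Nat.ListAction using (sum)
open import Data.Nat.Properties hiding (_≟_)
open import Data.Product using (Σ; ∃; ∃₂; _×_; _,_; proj₁; proj₂)
open import Data.Sum using (_⊎_; inj₁; inj₂)
open import Function.Base using (_∘_)
open import Function.Bundles using (_⇔_; mk⇔)
open import Relation.Binary.Definitions using (DecidableEquality)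
open import Relation.Binary.PropositionalEquality hiding ([_])
open import Relation.Nullary using (Dec; yes; no; does; contradiction)
open import Relation.Nullary.Decidable using (dec-true; does-⇔; map′; _×-dec_; _⊎-dec_)
open import Tactic.MonoidSolver using (solve)

All-reverse : {A : Set} {P : A → Set} (xs : List A) → All P xs → All P (reverse xs)
All-reverse xs = All-resp-↭ (↭-sym (↭-reverse xs))

length-∷ʳ : ∀ {A : Set} (xs : List A) x → length (xs ∷ʳ x) ≡ suc (length xs)
length-∷ʳ xs x = trans (length-++ xs) (+-comm (length xs) 1)

data Deletion {A : Set} : List A → List A → Set where
  here  : ∀ {a xs} → Deletion (a ∷ xs) xs
  there : ∀ {a xs ys} → Deletion xs ys → Deletion (a ∷ xs) (a ∷ ys)

Deletion-length : ∀ {A : Set} {xs ys : List A} → Deletion xs ys → length xs ≡ suc (length ys)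
Deletion-length here      = refl
Deletion-length (there d) = cong suc (Deletion-length d)

Deletion-All : ∀ {A : Set} {P : A → Set} {xs ys} → Deletion xs ys → All P xs → All P ys
Deletion-All here      (_ ∷ ps) = ps
Deletion-All (there d) (p ∷ ps) = p ∷ Deletion-All d ps

Deletion-++ : ∀ {A : Set} (xs ys : List A) {zs} → Deletion (xs ++ ys) zs →
  (∃ λ xs′ → Deletion xs xs′ × zs ≡ xs′ ++ ys) ⊎ (∃ λ ys′ → Deletion ys ys′ × zs ≡ xs ++ ys′)
Deletion-++ []       ys d         = inj₂ (_ , d , refl)
Deletion-++ (x ∷ xs) ys here      = inj₁ (xs , here , refl)
Deletion-++ (x ∷ xs) ys (there d) with Deletion-++ xs ys d
... | inj₁ (xs′ , d′ , refl) = inj₁ (x ∷ xs′ , there d′ , refl)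
... | inj₂ (ys′ , d′ , refl) = inj₂ (ys′ , d′ , refl)

xorUpTo : ℕ → (ℕ → Bool) → Bool
xorUpTo zero    f = false
xorUpTo (suc n) f = xorUpTo n f xor f n

xorUpTo-+ : ∀ m n f → xorUpTo (m + n) f ≡ xorUpTo m f xor xorUpTo n (λ l → f (m + l))
xorUpTo-+ m zero    f = trans (cong (λ k → xorUpTo k f) (+-identityʳ m)) (sym (xor-identityʳ _))
xorUpTo-+ m (suc n) f = begin
  xorUpTo (m + suc n) f                                ≡⟨ cong (λ k → xorUpTo k f) (+-suc m n) ⟩
  xorUpTo (m + n) f xor f (m + n)                      ≡⟨ cong (_xor f (m + n)) (xorUpTo-+ m n f) ⟩
  (xorUpTo m f xor xorUpTo n _) xor f (m + n)          ≡⟨ xor-assoc (xorUpTo m f) _ _ ⟩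
  xorUpTo m f xor xorUpTo (suc n) (λ l → f (m + l))    ∎
  where open ≡-Reasoning

xorUpTo-cong : ∀ n {f g} → (∀ l → f l ≡ g l) → xorUpTo n f ≡ xorUpTo n g
xorUpTo-cong zero    f≗g = refl
xorUpTo-cong (suc n) f≗g = cong₂ _xor_ (xorUpTo-cong n f≗g) (f≗g n)

xorUpTo-periodic : ∀ m f → (∀ l → f (m + l) ≡ f l) → xorUpTo (m + m) f ≡ false
xorUpTo-periodic m f periodic = begin
  xorUpTo (m + m) f                                  ≡⟨ xorUpTo-+ m m f ⟩
  xorUpTo m f xor xorUpTo m (λ l → f (m + l))        ≡⟨ cong (xorUpTo m f xor_) (xorUpTo-cong m periodic) ⟩
  xorUpTo m f xor xorUpTo m f                        ≡⟨ xor-same (xorUpTo m f) ⟩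
  false                                              ∎
  where open ≡-Reasoning

∀∈-⊥ : ∀ {n} {P : Fin n → Set} i → i ∈ ⊥ → P i
∀∈-⊥ i i∈⊥ = ⊥-elim (∉⊥ i∈⊥)

∀∈-∪ : ∀ {n} {P : Fin n → Set} {A B : Subset n} →
       (∀ i → i ∈ A → P i) → (∀ i → i ∈ B → P i) → ∀ i → i ∈ A ∪ B → P i
∀∈-∪ {A = A} {B} onA onB i i∈A∪B with x∈p∪q⁻ A B i∈A∪B
... | inj₁ i∈A = onA i i∈A
... | inj₂ i∈B = onB i i∈B

leftUnion rightUnion : ∀ {n} → List (Subset n × Subset n) → Subset n
leftUnion  = foldr (λ g A → proj₁ g ∪ A) ⊥
rightUnion = foldr (λ g A → proj₂ g ∪ A) ⊥

record Permutation (A : Set) : Set where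
  field
    to      : A → A
    from    : A → A
    to-from : ∀ x → to (from x) ≡ x
    from-to : ∀ x → from (to x) ≡ x

open Permutation

symmetricGroup : Set → Group 0ℓ 0ℓ
symmetricGroup A = record
  { Carrier = Permutation A
  ; _≈_     = λ f g → ∀ x → to f x ≡ to g x
  ; _∙_     = compose
  ; ε       = record { to = λ x → x ; from = λ x → x ; to-from = λ _ → refl ; from-to = λ _ → refl }
  ; _⁻¹     = λ f → record { to = from f ; from = to f ; to-from = from-to f ; from-to = to-from f }
  ; isGroup = record
    { isMonoid = record
      { isSemigroup = record
        { isMagma = record
          { isEquivalence = record
            { refl = λ _ → refl ; sym = λ f≈g x → sym (f≈g x) ; trans = λ f≈g g≈h x → trans (f≈g x) (g≈h x) }
          ; ∙-cong = λ {f} {f′} {g} f≈f′ g≈g′ x → trans (f≈f′ (to g x)) (cong (to f′) (g≈g′ x)) }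
        ; assoc = λ _ _ _ _ → refl }
      ; identity = (λ _ _ → refl) , (λ _ _ → refl) }
    ; inverse = (λ f → from-to f) , (λ f → to-from f)
    ; ⁻¹-cong = λ {f} {g} f≈g x →
        trans (sym (from-to g (from f x))) (cong (from g) (trans (sym (f≈g (from f x))) (to-from f x))) }
  }
  where
  compose : Permutation A → Permutation A → Permutation A
  compose f g = record
    { to      = λ x → to f (to g x)
    ; from    = λ x → from g (from f x)
    ; to-from = λ x → trans (cong (to f) (to-from g _)) (to-from f x)
    ; from-to = λ x → trans (cong (from g) (from-to f _)) (from-to g x)
    }

module CoxeterWords (C : FiniteCoxeterSystem) where

  open FiniteCoxeterSystem C public

  group : Group 0ℓ 0ℓ
  group = record { Carrier = W ; _≈_ = _≡_ ; _∙_ = _·_ ; ε = e ; _⁻¹ = _⁻¹ ; isGroup = isGroup }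

  open Group group public using (_∙_)

  monoid : Monoid 0ℓ 0ℓ
  monoid = Group.monoid group

  open IsGroup isGroup public using (assoc; identityˡ; identityʳ; inverseˡ; inverseʳ)
  open GroupProperties group public
    using ( ∙-cancelˡ; x∙y⁻¹≈ε⇒x≈y; x≈y⇒x∙y⁻¹≈ε; ⁻¹-involutive; ⁻¹-anti-homo-∙; ε⁻¹≈ε; inverseʳ-unique
          ; x≈z//y; y≈x\\z)

  s⁻¹≡s : ∀ i → s i ⁻¹ ≡ s i
  s⁻¹≡s i = sym (inverseʳ-unique (s i) (s i) (s²≡e i))

  ∙s∙s : ∀ w i → w ∙ s i ∙ s i ≡ w
  ∙s∙s w i = trans (assoc w (s i) (s i)) (trans (cong (w ∙_) (s²≡e i)) (identityʳ w))

  eval-++ : ∀ xs ys → eval (xs ++ ys) ≡ eval xs ∙ eval ys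
  eval-++ []       ys = sym (identityˡ _)
  eval-++ (x ∷ xs) ys = trans (cong (s x ∙_) (eval-++ xs ys)) (sym (assoc _ _ _))

  eval-∷ʳ : ∀ xs i → eval (xs ∷ʳ i) ≡ eval xs ∙ s i
  eval-∷ʳ xs i = trans (eval-++ xs [ i ]) (cong (eval xs ∙_) (identityʳ (s i)))

  ∙eval-∷ʳ : ∀ y xs i → y ∙ eval (xs ∷ʳ i) ≡ y ∙ eval xs ∙ s i
  ∙eval-∷ʳ y xs i = trans (cong (y ∙_) (eval-∷ʳ xs i)) (sym (assoc _ _ _))

  eval-reverse : ∀ xs → eval (reverse xs) ≡ eval xs ⁻¹
  eval-reverse []       = sym ε⁻¹≈ε
  eval-reverse (x ∷ xs) = begin
    eval (reverse (x ∷ xs))   ≡⟨ cong eval (unfold-reverse x xs) ⟩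
    eval (reverse xs ∷ʳ x)    ≡⟨ eval-∷ʳ (reverse xs) x ⟩
    eval (reverse xs) ∙ s x   ≡⟨ cong₂ _∙_ (eval-reverse xs) (sym (s⁻¹≡s x)) ⟩
    eval xs ⁻¹ ∙ s x ⁻¹       ≡⟨ sym (⁻¹-anti-homo-∙ (s x) (eval xs)) ⟩
    (s x ∙ eval xs) ⁻¹        ∎
    where open ≡-Reasoning

  eval-sandwich : ∀ as bs cs → eval (as ++ (bs ++ cs)) ≡ eval as ∙ eval bs ∙ eval cs
  eval-sandwich as bs cs = trans (eval-++ as (bs ++ cs)) (trans (cong (eval as ∙_) (eval-++ bs cs)) (sym (assoc _ _ _)))

  eval-conjugate : ∀ xs i → eval (xs ∷ʳ i ++ reverse xs) ≡ eval xs ∙ s i ∙ eval xs ⁻¹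
  eval-conjugate xs i = trans (eval-++ (xs ∷ʳ i) (reverse xs)) (cong₂ _∙_ (eval-∷ʳ xs i) (eval-reverse xs))

  ∙-sandwich-cancel : ∀ a y x cs i → a ∙ y ∙ eval cs ≡ a ∙ x ∙ eval cs ∙ s i → y ≡ x ∙ eval (cs ∷ʳ i ++ reverse cs)
  ∙-sandwich-cancel a y x cs i eq = begin
    y                                   ≡⟨ x≈z//y y (eval cs) (x ∙ eval cs ∙ s i) (∙-cancelˡ a _ _ a-cancelled) ⟩
    x ∙ eval cs ∙ s i ∙ eval cs ⁻¹      ≡⟨ solve monoid ⟩
    x ∙ (eval cs ∙ s i ∙ eval cs ⁻¹)    ≡⟨ cong (x ∙_) (eval-conjugate cs i) ⟨
    x ∙ eval (cs ∷ʳ i ++ reverse cs)    ∎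
    where
    open ≡-Reasoning
    a-cancelled : a ∙ (y ∙ eval cs) ≡ a ∙ (x ∙ eval cs ∙ s i)
    a-cancelled = begin
      a ∙ (y ∙ eval cs)         ≡⟨ solve monoid ⟩
      a ∙ y ∙ eval cs           ≡⟨ eq ⟩
      a ∙ x ∙ eval cs ∙ s i     ≡⟨ solve monoid ⟩
      a ∙ (x ∙ eval cs ∙ s i)   ∎

  conj : W → W → W
  conj g t = g ∙ t ∙ g ⁻¹

  conj-e : ∀ t → conj e t ≡ t
  conj-e t = trans (cong₂ _∙_ (identityˡ t) ε⁻¹≈ε) (identityʳ t)

  conj-∙ : ∀ g h t → conj g (conj h t) ≡ conj (g ∙ h) t
  conj-∙ g h t = begin
    g ∙ (h ∙ t ∙ h ⁻¹) ∙ g ⁻¹   ≡⟨ cong (_∙ g ⁻¹) (sym (assoc g (h ∙ t) (h ⁻¹))) ⟩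
    g ∙ (h ∙ t) ∙ h ⁻¹ ∙ g ⁻¹   ≡⟨ assoc (g ∙ (h ∙ t)) (h ⁻¹) (g ⁻¹) ⟩
    g ∙ (h ∙ t) ∙ (h ⁻¹ ∙ g ⁻¹) ≡⟨ cong₂ _∙_ (sym (assoc g h t)) (sym (⁻¹-anti-homo-∙ g h)) ⟩
    g ∙ h ∙ t ∙ (g ∙ h) ⁻¹      ∎
    where open ≡-Reasoning

  conj-s : ∀ i t → s i ∙ t ∙ s i ≡ conj (s i) t
  conj-s i t = cong (s i ∙ t ∙_) (sym (s⁻¹≡s i))

  conj-s-s : ∀ i → conj (s i) (s i) ≡ s i
  conj-s-s i = trans (sym (conj-s i (s i))) (trans (cong (_∙ s i) (s²≡e i)) (identityˡ (s i)))

  conj≡⇔ : ∀ g t y → conj g t ≡ y ⇔ t ≡ g ⁻¹ ∙ y ∙ g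
  conj≡⇔ g t y = mk⇔
    (λ eq → trans (sym (conj⁻¹-conj g t)) (cong (λ u → g ⁻¹ ∙ u ∙ g) eq))
    (λ eq → trans (cong (conj g) eq) (conj-conj⁻¹ g y))
    where
    conj⁻¹-conj : ∀ g t → g ⁻¹ ∙ conj g t ∙ g ≡ t
    conj⁻¹-conj g t = begin
      g ⁻¹ ∙ (g ∙ t ∙ g ⁻¹) ∙ g     ≡⟨ solve monoid ⟩
      (g ⁻¹ ∙ g) ∙ t ∙ (g ⁻¹ ∙ g)   ≡⟨ cong₂ (λ a b → a ∙ t ∙ b) (inverseˡ g) (inverseˡ g) ⟩
      e ∙ t ∙ e                     ≡⟨ solve monoid ⟩
      t                             ∎
      where open ≡-Reasoning
    conj-conj⁻¹ : ∀ g y → conj g (g ⁻¹ ∙ y ∙ g) ≡ y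
    conj-conj⁻¹ g y = begin
      g ∙ (g ⁻¹ ∙ y ∙ g) ∙ g ⁻¹     ≡⟨ solve monoid ⟩
      (g ∙ g ⁻¹) ∙ y ∙ (g ∙ g ⁻¹)   ≡⟨ cong₂ (λ a b → a ∙ y ∙ b) (inverseʳ g) (inverseʳ g) ⟩
      e ∙ y ∙ e                     ≡⟨ solve monoid ⟩
      y                             ∎
      where open ≡-Reasoning

  conj∙≡∙ : ∀ g t → conj g t ∙ g ≡ g ∙ t
  conj∙≡∙ g t = begin
    g ∙ t ∙ g ⁻¹ ∙ g    ≡⟨ assoc _ _ _ ⟩
    g ∙ t ∙ (g ⁻¹ ∙ g)  ≡⟨ cong (g ∙ t ∙_) (inverseˡ g) ⟩
    g ∙ t ∙ e           ≡⟨ identityʳ _ ⟩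
    g ∙ t               ∎
    where open ≡-Reasoning

  infixr 8 _^_
  _^_ : W → ℕ → W
  x ^ k = pow _·_ e x k

  ^-+ : ∀ x m n → x ^ (m + n) ≡ x ^ m ∙ x ^ n
  ^-+ x zero    n = sym (identityˡ _)
  ^-+ x (suc m) n = trans (cong (x ∙_) (^-+ x m n)) (sym (assoc _ _ _))

  ^-comm : ∀ x k → x ^ k ∙ x ≡ x ∙ x ^ k
  ^-comm x zero    = trans (identityˡ x) (sym (identityʳ x))
  ^-comm x (suc k) = trans (assoc _ _ _) (cong (x ∙_) (^-comm x k))

  ^-⁻¹ : ∀ x k → (x ^ k) ⁻¹ ≡ (x ⁻¹) ^ k
  ^-⁻¹ x zero    = ε⁻¹≈ε
  ^-⁻¹ x (suc k) = begin
    (x ∙ x ^ k) ⁻¹          ≡⟨ ⁻¹-anti-homo-∙ x (x ^ k) ⟩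
    (x ^ k) ⁻¹ ∙ x ⁻¹       ≡⟨ cong (_∙ x ⁻¹) (^-⁻¹ x k) ⟩
    (x ⁻¹) ^ k ∙ x ⁻¹       ≡⟨ ^-comm (x ⁻¹) k ⟩
    x ⁻¹ ∙ (x ⁻¹) ^ k       ∎
    where open ≡-Reasoning

  WordOver : Subset r → List (Fin r) → Set
  WordOver J = All (_∈ J)

  InParabolic-e : ∀ {J} → InParabolic C J e
  InParabolic-e = [] , [] , refl

  InParabolic-∙ : ∀ {J a b} → InParabolic C J a → InParabolic C J b → InParabolic C J (a ∙ b)
  InParabolic-∙ (as , asJ , refl) (bs , bsJ , refl) = as ++ bs , ++⁺ asJ bsJ , eval-++ as bs

  InParabolic-⁻¹ : ∀ {J a} → InParabolic C J a → InParabolic C J (a ⁻¹)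
  InParabolic-⁻¹ (as , asJ , refl) = reverse as , All-reverse as asJ , eval-reverse as

  InParabolic-⊆ : ∀ {J K a} → J ⊆ K → InParabolic C J a → InParabolic C K a
  InParabolic-⊆ J⊆K (as , asJ , eq) = as , All.map J⊆K asJ , eq

  SameDoubleCoset : Subset r → Subset r → W → W → Set
  SameDoubleCoset U V x y = ∃₂ λ a b → InParabolic C U a × InParabolic C V b × y ≡ a ∙ x ∙ b

  SameDoubleCoset-sym : ∀ {U V x y} → SameDoubleCoset U V x y → SameDoubleCoset U V y x
  SameDoubleCoset-sym {x = x} (a , b , aU , bV , refl) = a ⁻¹ , b ⁻¹ , InParabolic-⁻¹ aU , InParabolic-⁻¹ bV , (begin
    x                              ≡⟨ solve monoid ⟩
    e ∙ x ∙ e                      ≡⟨ cong₂ (λ u v → u ∙ x ∙ v) (inverseˡ a) (inverseʳ b) ⟨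
    a ⁻¹ ∙ a ∙ x ∙ (b ∙ b ⁻¹)      ≡⟨ solve monoid ⟩
    a ⁻¹ ∙ (a ∙ x ∙ b) ∙ b ⁻¹      ∎)
    where open ≡-Reasoning

  SameDoubleCoset-trans : ∀ {U V x y z} → SameDoubleCoset U V x y → SameDoubleCoset U V y z → SameDoubleCoset U V x z
  SameDoubleCoset-trans {x = x} (a , b , aU , bV , refl) (a′ , b′ , a′U , b′V , refl) =
    a′ ∙ a , b ∙ b′ , InParabolic-∙ a′U aU , InParabolic-∙ bV b′V , solve monoid

  SameDoubleCoset-⊆ : ∀ {U U′ V V′ x y} → U ⊆ U′ → V ⊆ V′ → SameDoubleCoset U V x y → SameDoubleCoset U′ V′ x y
  SameDoubleCoset-⊆ U⊆U′ V⊆V′ (a , b , aU , bV , eq) = a , b , InParabolic-⊆ U⊆U′ aU , InParabolic-⊆ V⊆V′ bV , eq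

module TitsRepresentation (C : FiniteCoxeterSystem) (_≟_ : DecidableEquality (FiniteCoxeterSystem.W C)) where

  open CoxeterWords C

  reflect : Fin r → W × Bool → W × Bool
  reflect i (t , β) = (s i ∙ t ∙ s i , β xor does (t ≟ s i))

  does-conj≟ : ∀ g t y → does (conj g t ≟ y) ≡ does (t ≟ (g ⁻¹ ∙ y ∙ g))
  does-conj≟ g t y = does-⇔ (conj≡⇔ g t y) (conj g t ≟ y) (t ≟ (g ⁻¹ ∙ y ∙ g))

  does-s∙∙s≟s : ∀ i t → does ((s i ∙ t ∙ s i) ≟ s i) ≡ does (t ≟ s i)
  does-s∙∙s≟s i t = begin
    does ((s i ∙ t ∙ s i) ≟ s i)      ≡⟨ cong (λ u → does (u ≟ s i)) (conj-s i t) ⟩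
    does (conj (s i) t ≟ s i)         ≡⟨ does-conj≟ (s i) t (s i) ⟩
    does (t ≟ (s i ⁻¹ ∙ s i ∙ s i))   ≡⟨ cong (λ u → does (t ≟ (u ∙ s i ∙ s i))) (s⁻¹≡s i) ⟩
    does (t ≟ (s i ∙ s i ∙ s i))      ≡⟨ cong (λ u → does (t ≟ u)) (trans (cong (_∙ s i) (s²≡e i)) (identityˡ (s i))) ⟩
    does (t ≟ s i)                    ∎
    where open ≡-Reasoning

  reflect-involutive : ∀ i x → reflect i (reflect i x) ≡ x
  reflect-involutive i (t , β) = cong₂ _,_
    (begin
      s i ∙ (s i ∙ t ∙ s i) ∙ s i     ≡⟨ solve monoid ⟩
      (s i ∙ s i) ∙ t ∙ (s i ∙ s i)   ≡⟨ cong₂ (λ a b → a ∙ t ∙ b) (s²≡e i) (s²≡e i) ⟩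
      e ∙ t ∙ e                       ≡⟨ solve monoid ⟩
      t                               ∎)
    (begin
      (β xor does (t ≟ s i)) xor does ((s i ∙ t ∙ s i) ≟ s i)   ≡⟨ cong ((β xor does (t ≟ s i)) xor_) (does-s∙∙s≟s i t) ⟩
      (β xor does (t ≟ s i)) xor does (t ≟ s i)                 ≡⟨ xor-assoc β _ _ ⟩
      β xor (does (t ≟ s i) xor does (t ≟ s i))                 ≡⟨ cong (β xor_) (xor-same (does (t ≟ s i))) ⟩
      β xor false                                               ≡⟨ xor-identityʳ β ⟩
      β                                                         ∎)
    where open ≡-Reasoning

  reflectWord : List (Fin r) → W × Bool → W × Bool
  reflectWord []       x = x
  reflectWord (i ∷ ws) x = reflect i (reflectWord ws x)

  -- η ws t is the parity of the letters i of ws, with suffix ws′ after them, such that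
  -- t ≡ (eval ws′)⁻¹ ∙ s i ∙ eval ws′; through φ below it depends only on eval ws.
  η : List (Fin r) → W → Bool
  η []       t = false
  η (i ∷ ws) t = η ws t xor does (conj (eval ws) t ≟ s i)

  reflectWord-η : ∀ ws t β → reflectWord ws (t , β) ≡ (conj (eval ws) t , β xor η ws t)
  reflectWord-η []       t β = sym (cong₂ _,_ (conj-e t) (xor-identityʳ β))
  reflectWord-η (i ∷ ws) t β rewrite reflectWord-η ws t β =
    cong₂ _,_ (trans (conj-s i _) (conj-∙ (s i) (eval ws) t)) (xor-assoc β _ _)

  module Braid (i j : Fin r) where

    p q : W
    p = s i ∙ s j
    q = s j ∙ s i

    braidWord : ℕ → List (Fin r)
    braidWord zero    = []
    braidWord (suc k) = i ∷ j ∷ braidWord k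

    eval-braidWord : ∀ k → eval (braidWord k) ≡ p ^ k
    eval-braidWord zero    = refl
    eval-braidWord (suc k) = trans (sym (assoc (s i) (s j) _)) (cong (p ∙_) (eval-braidWord k))

    p^⁻¹ : ∀ k → (p ^ k) ⁻¹ ≡ q ^ k
    p^⁻¹ k = trans (^-⁻¹ p k) (cong (_^ k) (trans (⁻¹-anti-homo-∙ (s i) (s j)) (cong₂ _∙_ (s⁻¹≡s j) (s⁻¹≡s i))))

    s∙p^ : ∀ k → s j ∙ p ^ k ≡ q ^ k ∙ s j
    s∙p^ zero    = trans (identityʳ _) (sym (identityˡ _))
    s∙p^ (suc k) = begin
      s j ∙ (s i ∙ s j ∙ p ^ k)       ≡⟨ solve monoid ⟩
      s j ∙ s i ∙ (s j ∙ p ^ k)       ≡⟨ cong (q ∙_) (s∙p^ k) ⟩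
      s j ∙ s i ∙ (q ^ k ∙ s j)       ≡⟨ solve monoid ⟩
      s j ∙ s i ∙ q ^ k ∙ s j         ∎
      where open ≡-Reasoning

    -- The reflections met along (i j)^k are q^l ∙ s j for l < 2k. Since q has order m i j they
    -- repeat with period m i j, so along (i j)^(m i j) each one is met an even number of times.
    crossing : W → ℕ → Bool
    crossing t l = does (t ≟ (q ^ l ∙ s j))

    crossing-even : ∀ k t → does (conj (p ^ k) t ≟ s j) ≡ crossing t (k + k)
    crossing-even k t = trans (does-conj≟ (p ^ k) t (s j)) (cong (λ u → does (t ≟ u)) (begin
      (p ^ k) ⁻¹ ∙ s j ∙ p ^ k        ≡⟨ cong (λ u → u ∙ s j ∙ p ^ k) (p^⁻¹ k) ⟩
      q ^ k ∙ s j ∙ p ^ k             ≡⟨ assoc _ _ _ ⟩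
      q ^ k ∙ (s j ∙ p ^ k)           ≡⟨ cong (q ^ k ∙_) (s∙p^ k) ⟩
      q ^ k ∙ (q ^ k ∙ s j)           ≡⟨ sym (assoc _ _ _) ⟩
      q ^ k ∙ q ^ k ∙ s j             ≡⟨ cong (_∙ s j) (sym (^-+ q k k)) ⟩
      q ^ (k + k) ∙ s j               ∎))
      where open ≡-Reasoning

    crossing-odd : ∀ k t → does (conj (s j ∙ p ^ k) t ≟ s i) ≡ crossing t (suc (k + k))
    crossing-odd k t = trans (does-conj≟ (s j ∙ p ^ k) t (s i)) (cong (λ u → does (t ≟ u)) (begin
      (s j ∙ p ^ k) ⁻¹ ∙ s i ∙ (s j ∙ p ^ k)       ≡⟨ cong (λ u → u ∙ s i ∙ (s j ∙ p ^ k)) (⁻¹-anti-homo-∙ (s j) (p ^ k)) ⟩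
      (p ^ k) ⁻¹ ∙ s j ⁻¹ ∙ s i ∙ (s j ∙ p ^ k)    ≡⟨ cong₂ (λ u v → u ∙ v ∙ s i ∙ (s j ∙ p ^ k)) (p^⁻¹ k) (s⁻¹≡s j) ⟩
      q ^ k ∙ s j ∙ s i ∙ (s j ∙ p ^ k)            ≡⟨ cong (λ u → q ^ k ∙ s j ∙ s i ∙ u) (s∙p^ k) ⟩
      q ^ k ∙ s j ∙ s i ∙ (q ^ k ∙ s j)            ≡⟨ solve monoid ⟩
      q ^ k ∙ (s j ∙ s i) ∙ q ^ k ∙ s j            ≡⟨ cong (λ u → u ∙ q ^ k ∙ s j) (^-comm q k) ⟩
      (s j ∙ s i) ∙ q ^ k ∙ q ^ k ∙ s j            ≡⟨ solve monoid ⟩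
      (s j ∙ s i) ∙ (q ^ k ∙ q ^ k) ∙ s j          ≡⟨ cong (λ u → q ∙ u ∙ s j) (sym (^-+ q k k)) ⟩
      q ^ suc (k + k) ∙ s j                        ∎))
      where open ≡-Reasoning

    η-braidWord : ∀ k t → η (braidWord k) t ≡ xorUpTo (k + k) (crossing t)
    η-braidWord zero    t = refl
    η-braidWord (suc k) t = begin
      (η (braidWord k) t xor does (conj (eval (braidWord k)) t ≟ s j)) xor does (conj (s j ∙ eval (braidWord k)) t ≟ s i)
        ≡⟨ cong₂ (λ a w → (a xor does (conj w t ≟ s j)) xor does (conj (s j ∙ w) t ≟ s i)) (η-braidWord k t) (eval-braidWord k) ⟩
      (xorUpTo (k + k) (crossing t) xor does (conj (p ^ k) t ≟ s j)) xor does (conj (s j ∙ p ^ k) t ≟ s i)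
        ≡⟨ cong₂ (λ a b → (xorUpTo (k + k) (crossing t) xor a) xor b) (crossing-even k t) (crossing-odd k t) ⟩
      xorUpTo (suc (suc (k + k))) (crossing t)
        ≡⟨ cong (λ n → xorUpTo (suc n) (crossing t)) (sym (+-suc k k)) ⟩
      xorUpTo (suc k + suc k) (crossing t) ∎
      where open ≡-Reasoning

    q^m≡e : q ^ m i j ≡ e
    q^m≡e = trans (sym (p^⁻¹ (m i j))) (trans (cong _⁻¹ (m-rel i j)) ε⁻¹≈ε)

    reflectWord-braid : ∀ x → reflectWord (braidWord (m i j)) x ≡ x
    reflectWord-braid (t , β) = trans (reflectWord-η (braidWord (m i j)) t β) (cong₂ _,_
      (trans (cong (λ w → conj w t) (trans (eval-braidWord (m i j)) (m-rel i j))) (conj-e t))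
      (trans (cong (β xor_) (trans (η-braidWord (m i j) t) (xorUpTo-periodic (m i j) (crossing t) periodic))) (xor-identityʳ β)))
      where
      periodic : ∀ l → crossing t (m i j + l) ≡ crossing t l
      periodic l = cong (λ u → does (t ≟ (u ∙ s j))) (trans (^-+ q (m i j) l) (trans (cong (_∙ q ^ l) q^m≡e) (identityˡ _)))

  reflectPermutation : Fin r → Permutation (W × Bool)
  reflectPermutation i = record
    { to = reflect i ; from = reflect i ; to-from = reflect-involutive i ; from-to = reflect-involutive i }

  private
    Sym : Group 0ℓ 0ℓ
    Sym = symmetricGroup (W × Bool)
    open Group Sym using () renaming (_∙_ to _∘ₚ_; ε to idₚ)

  power-reflect : ∀ i j k x →
    to (pow _∘ₚ_ idₚ (reflectPermutation i ∘ₚ reflectPermutation j) k) x ≡ reflectWord (Braid.braidWord i j k) x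
  power-reflect i j zero    x = refl
  power-reflect i j (suc k) x = cong (λ y → reflect i (reflect j y)) (power-reflect i j k x)

  homomorphism : Σ (W → Permutation (W × Bool)) λ φ →
    (∀ x y → Group._≈_ Sym (φ (x · y)) (φ x ∘ₚ φ y)) × (∀ i → Group._≈_ Sym (φ (s i)) (reflectPermutation i))
  homomorphism = presentation Sym reflectPermutation
    (λ i j x → trans (power-reflect i j (m i j) x) (Braid.reflectWord-braid i j x))

  φ : W → Permutation (W × Bool)
  φ = proj₁ homomorphism

  φ-e : ∀ x → to (φ e) x ≡ x
  φ-e = GroupProperties.identityˡ-unique Sym (φ e) (φ e)
    (λ x → trans (sym (proj₁ (proj₂ homomorphism) e e x)) (cong (λ w → to (φ w) x) (identityˡ e)))

  φ-eval : ∀ ws x → to (φ (eval ws)) x ≡ reflectWord ws x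
  φ-eval []       x = φ-e x
  φ-eval (i ∷ ws) x = begin
    to (φ (s i ∙ eval ws)) x             ≡⟨ proj₁ (proj₂ homomorphism) (s i) (eval ws) x ⟩
    to (φ (s i)) (to (φ (eval ws)) x)    ≡⟨ proj₂ (proj₂ homomorphism) i _ ⟩
    reflect i (to (φ (eval ws)) x)       ≡⟨ cong (reflect i) (φ-eval ws x) ⟩
    reflect i (reflectWord ws x)         ∎
    where open ≡-Reasoning

  η-invariant : ∀ ws vs t → eval ws ≡ eval vs → η ws t ≡ η vs t
  η-invariant ws vs t eq = cong proj₂ (begin
    (conj (eval ws) t , η ws t)          ≡⟨ reflectWord-η ws t false ⟨
    reflectWord ws (t , false)           ≡⟨ φ-eval ws _ ⟨
    to (φ (eval ws)) (t , false)         ≡⟨ cong (λ w → to (φ w) (t , false)) eq ⟩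
    to (φ (eval vs)) (t , false)         ≡⟨ φ-eval vs _ ⟩
    reflectWord vs (t , false)           ≡⟨ reflectWord-η vs t false ⟩
    (conj (eval vs) t , η vs t)          ∎)
    where open ≡-Reasoning

  η-deletion : ∀ ws t → η ws t ≡ true → ∃ λ ws′ → Deletion ws ws′ × eval ws′ ≡ eval ws ∙ t
  η-deletion (i ∷ ws) t η≡true with conj (eval ws) t ≟ s i
  ... | yes conj≡s = ws , here , sym (begin
    s i ∙ eval ws ∙ t                    ≡⟨ assoc _ _ _ ⟩
    s i ∙ (eval ws ∙ t)                  ≡⟨ cong (s i ∙_) (sym (conj∙≡∙ (eval ws) t)) ⟩
    s i ∙ (conj (eval ws) t ∙ eval ws)   ≡⟨ cong (λ u → s i ∙ (u ∙ eval ws)) conj≡s ⟩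
    s i ∙ (s i ∙ eval ws)                ≡⟨ sym (assoc _ _ _) ⟩
    s i ∙ s i ∙ eval ws                  ≡⟨ cong (_∙ eval ws) (s²≡e i) ⟩
    e ∙ eval ws                          ≡⟨ identityˡ _ ⟩
    eval ws                              ∎)
    where open ≡-Reasoning
  ... | no _ with η-deletion ws t (trans (sym (xor-identityʳ _)) η≡true)
  ...   | ws′ , del , eq = i ∷ ws′ , there del , trans (cong (s i ∙_) eq) (sym (assoc _ _ _))

  η-∷ʳ : ∀ ws i → η (ws ∷ʳ i) (s i) ≡ not (η ws (s i))
  η-∷ʳ []       i = dec-true (conj e (s i) ≟ s i) (conj-e (s i))
  η-∷ʳ (j ∷ ws) i = begin
    η (ws ∷ʳ i) (s i) xor does (conj (eval (ws ∷ʳ i)) (s i) ≟ s j)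
      ≡⟨ cong₂ (λ a w → a xor does (conj w (s i) ≟ s j)) (η-∷ʳ ws i) (eval-∷ʳ ws i) ⟩
    not (η ws (s i)) xor does (conj (eval ws ∙ s i) (s i) ≟ s j)
      ≡⟨ cong (λ u → not (η ws (s i)) xor does (u ≟ s j))
              (trans (sym (conj-∙ (eval ws) (s i) (s i))) (cong (conj (eval ws)) (conj-s-s i))) ⟩
    not (η ws (s i)) xor does (conj (eval ws) (s i) ≟ s j)
      ≡⟨ sym (not-distribˡ-xor (η ws (s i)) _) ⟩
    not (η ws (s i) xor does (conj (eval ws) (s i) ≟ s j)) ∎
    where open ≡-Reasoning

module LengthFunction (C : FiniteCoxeterSystem) (ℓ : FiniteCoxeterSystem.W C → ℕ) (isℓ : IsLengthFunction C ℓ) where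

  open CoxeterWords C public

  reducedWord : ∀ w → ∃ λ ws → eval ws ≡ w × length ws ≡ ℓ w
  reducedWord w = proj₁ (isℓ w)

  ℓ≤length : ∀ ws {w} → eval ws ≡ w → ℓ w ≤ length ws
  ℓ≤length ws {w} = proj₂ (isℓ w) ws

  ℓ-e : ℓ e ≡ 0
  ℓ-e = n≤0⇒n≡0 (ℓ≤length [] refl)

  ℓ≡0⇒≡e : ∀ w → ℓ w ≡ 0 → w ≡ e
  ℓ≡0⇒≡e w ℓw≡0 with reducedWord w
  ... | []    , eval≡w , _ = sym eval≡w
  ... | _ ∷ _ , _ , len≡ℓw = contradiction (trans len≡ℓw ℓw≡0) λ ()

  _≟_ : DecidableEquality W
  x ≟ y = map′ (λ ℓ≡0 → x∙y⁻¹≈ε⇒x≈y x y (ℓ≡0⇒≡e _ ℓ≡0)) (λ x≡y → trans (cong ℓ (x≈y⇒x∙y⁻¹≈ε x≡y)) ℓ-e)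
               (ℓ (x ∙ y ⁻¹) ℕ.≟ 0)

  open TitsRepresentation C _≟_ using (η; η-deletion; η-∷ʳ; η-invariant)

  ℓ-∙ : ∀ x y → ℓ (x ∙ y) ≤ ℓ x + ℓ y
  ℓ-∙ x y with reducedWord x | reducedWord y
  ... | xs , refl , ℓx | ys , refl , ℓy =
    subst₂ _≤_ refl (trans (length-++ xs) (cong₂ _+_ ℓx ℓy)) (ℓ≤length (xs ++ ys) (eval-++ xs ys))

  ℓ-⁻¹ : ∀ x → ℓ (x ⁻¹) ≡ ℓ x
  ℓ-⁻¹ x = ≤-antisym (ℓ⁻¹≤ x) (subst (λ u → ℓ u ≤ ℓ (x ⁻¹)) (⁻¹-involutive x) (ℓ⁻¹≤ (x ⁻¹)))
    where
    ℓ⁻¹≤ : ∀ x → ℓ (x ⁻¹) ≤ ℓ x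
    ℓ⁻¹≤ x with reducedWord x
    ... | xs , refl , ℓx = subst (ℓ (eval xs ⁻¹) ≤_) (trans (length-reverse xs) ℓx) (ℓ≤length (reverse xs) (eval-reverse xs))

  ℓ-∙s≤ : ∀ w i → ℓ (w ∙ s i) ≤ suc (ℓ w)
  ℓ-∙s≤ w i = ≤-trans (ℓ-∙ w (s i)) (subst (ℓ w + ℓ (s i) ≤_) (+-comm (ℓ w) 1)
    (+-monoʳ-≤ (ℓ w) (ℓ≤length [ i ] (identityʳ (s i)))))

  -- If η ws (s i) were false, a reduced word for w ∙ s i would have η true, and deleting a letter
  -- from it would give a word for w shorter than ℓ (w ∙ s i) ≤ ℓ w.
  exchange : ∀ {w} i ws → eval ws ≡ w → length ws ≡ ℓ w → ℓ (w ∙ s i) ≤ ℓ w →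
             ∃ λ ws′ → Deletion ws ws′ × eval ws′ ≡ w ∙ s i
  exchange i ws refl reduced descent with η ws (s i) in η≡
  ... | true  = η-deletion ws (s i) η≡
  ... | false with reducedWord (eval ws ∙ s i)
  ...   | zs , eval-zs , ℓzs with η-deletion zs (s i) η-zs
    where
    η-zs : η zs (s i) ≡ true
    η-zs = trans (η-invariant zs (ws ∷ʳ i) (s i) (trans eval-zs (sym (eval-∷ʳ ws i))))
                 (trans (η-∷ʳ ws i) (cong not η≡))
  ...     | zs′ , del , eval-zs′ = contradiction descent (<⇒≱ (begin-strict
    ℓ (eval ws)           ≤⟨ ℓ≤length zs′ (trans eval-zs′ (trans (cong (_∙ s i) eval-zs) (∙s∙s (eval ws) i))) ⟩
    length zs′            <⟨ n<1+n _ ⟩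
    suc (length zs′)      ≡⟨ Deletion-length del ⟨
    length zs             ≡⟨ ℓzs ⟩
    ℓ (eval ws ∙ s i)     ∎))
    where open ≤-Reasoning

  ℓ-∙s : ∀ w i → ℓ (w ∙ s i) ≡ suc (ℓ w) ⊎ suc (ℓ (w ∙ s i)) ≡ ℓ w
  ℓ-∙s w i with ℓ w <? ℓ (w ∙ s i)
  ... | yes ascent = inj₁ (≤-antisym (ℓ-∙s≤ w i) ascent)
  ... | no ¬ascent with reducedWord w
  ...   | ws , refl , ℓws with exchange i ws refl ℓws (≮⇒≥ ¬ascent)
  ...     | ws′ , del , eval-ws′ = inj₂ (≤-antisym
    (subst (suc (ℓ (eval ws ∙ s i)) ≤_) (trans (sym (Deletion-length del)) ℓws) (s≤s (ℓ≤length ws′ eval-ws′)))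
    (subst (λ u → ℓ u ≤ suc (ℓ (eval ws ∙ s i))) (∙s∙s (eval ws) i) (ℓ-∙s≤ (eval ws ∙ s i) i)))

  Reduced : List (Fin r) → Set
  Reduced ws = ℓ (eval ws) ≡ length ws

  reduce : ∀ {J} ws → WordOver J ws →
           ∃ λ vs → WordOver J vs × Reduced vs × eval vs ≡ eval ws × length vs ≤ length ws
  reduce {J} ws = go (reverseView ws)
    where
    go : ∀ {ws} → Reverse ws → WordOver J ws →
         ∃ λ vs → WordOver J vs × Reduced vs × eval vs ≡ eval ws × length vs ≤ length ws
    go [] [] = [] , [] , ℓ-e , refl , z≤n
    go (ws ∶ rs ∶ʳ i) wsiJ with ∷ʳ⁻ wsiJ
    ... | wsJ , iJ with go rs wsJ
    ...   | vs , vsJ , reduced , eval≡ , len≤ with ℓ-∙s (eval vs) i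
    ...     | inj₁ ascent = vs ∷ʳ i , ∷ʳ⁺ vsJ iJ ,
      trans (cong ℓ (eval-∷ʳ vs i)) (trans ascent (trans (cong suc reduced) (sym (length-∷ʳ vs i)))) ,
      trans (eval-∷ʳ vs i) (trans (cong (_∙ s i) eval≡) (sym (eval-∷ʳ ws i))) ,
      subst₂ _≤_ (sym (length-∷ʳ vs i)) (sym (length-∷ʳ ws i)) (s≤s len≤)
    ...     | inj₂ descent with exchange i vs refl (sym reduced) (≤-trans (n≤1+n _) (≤-reflexive descent))
    ...       | vs′ , del , eval-vs′ = vs′ , Deletion-All del vsJ ,
      suc-injective (trans (cong (suc ∘ ℓ) eval-vs′) (trans descent (trans reduced (Deletion-length del)))) ,
      trans eval-vs′ (trans (cong (_∙ s i) eval≡) (sym (eval-∷ʳ ws i))) ,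
      subst (length vs′ ≤_) (sym (length-∷ʳ ws i))
        (m≤n⇒m≤1+n (≤-trans (≤-trans (n≤1+n _) (≤-reflexive (sym (Deletion-length del)))) len≤))

  Reduced-∷ʳ⁻ : ∀ ws i → Reduced (ws ∷ʳ i) → Reduced ws
  Reduced-∷ʳ⁻ ws i reduced = ≤-antisym (ℓ≤length ws refl) (ℕ.s≤s⁻¹ (begin
    suc (length ws)          ≡⟨ length-∷ʳ ws i ⟨
    length (ws ∷ʳ i)         ≡⟨ reduced ⟨
    ℓ (eval (ws ∷ʳ i))       ≡⟨ cong ℓ (eval-∷ʳ ws i) ⟩
    ℓ (eval ws ∙ s i)        ≤⟨ ℓ-∙s≤ (eval ws) i ⟩
    suc (ℓ (eval ws))        ∎))
    where open ≤-Reasoning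

module Cosets (C : FiniteCoxeterSystem) (ℓ : FiniteCoxeterSystem.W C → ℕ) (isℓ : IsLengthFunction C ℓ) where

  open LengthFunction C ℓ isℓ public

  RightCosetMinimal : Subset r → W → Set
  RightCosetMinimal J x = ∀ c → WordOver J c → ℓ x ≤ ℓ (x ∙ eval c)

  -- Append the letters of c one at a time to the reduced word d ++ xs of eval d ∙ x: at a descent
  -- the exchange condition deletes a letter, which cannot lie in xs because x is minimal in x W_V;
  -- a deletion in d or in c shortens the pair (d , c).
  module TwoSidedExchange (U V : Subset r) (x : W) (x-minimal : RightCosetMinimal V x) where

    Shortening : List (Fin r) → List (Fin r) → Set
    Shortening d c = ∃₂ λ d′ c′ → WordOver U d′ × WordOver V c′ ×
      length d′ + length c′ < length d + length c × eval d ∙ x ∙ eval c ≡ eval d′ ∙ x ∙ eval c′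

    xs : List (Fin r)
    xs = proj₁ (reducedWord x)

    eval-xs : eval xs ≡ x
    eval-xs = proj₁ (proj₂ (reducedWord x))

    length-xs : length xs ≡ ℓ x
    length-xs = proj₂ (proj₂ (reducedWord x))

    eval-d-xs-c : ∀ d c → eval (d ++ (xs ++ c)) ≡ eval d ∙ x ∙ eval c
    eval-d-xs-c d c = trans (eval-sandwich d xs c) (cong (λ u → eval d ∙ u ∙ eval c) eval-xs)

    shortened : ∀ d c b d′ c′ → eval (d′ ++ (xs ++ c′)) ≡ eval d ∙ x ∙ eval c ∙ s b →
                eval d ∙ x ∙ eval (c ∷ʳ b) ≡ eval d′ ∙ x ∙ eval c′
    shortened d c b d′ c′ eq = trans (∙eval-∷ʳ (eval d ∙ x) c b) (trans (sym eq) (eval-d-xs-c d′ c′))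

    descent-shortens : ∀ {d c b} → WordOver U d → WordOver V c → b ∈ V →
      ℓ (eval d ∙ x ∙ eval c) ≡ length d + ℓ x + length c →
      ℓ (eval d ∙ x ∙ eval c ∙ s b) ≤ ℓ (eval d ∙ x ∙ eval c) → Shortening d (c ∷ʳ b)
    descent-shortens {d} {c} {b} dU cV bV additive descent
      with exchange b (d ++ (xs ++ c)) (eval-d-xs-c d c) length-dxc descent
      where
      length-dxc : length (d ++ (xs ++ c)) ≡ ℓ (eval d ∙ x ∙ eval c)
      length-dxc = trans (length-++ d) (trans (cong (length d +_) (trans (length-++ xs) (cong (_+ length c) length-xs)))
                     (trans (sym (+-assoc (length d) (ℓ x) (length c))) (sym additive)))
    ... | _ , del , eval-del with Deletion-++ d (xs ++ c) del
    ...   | inj₁ (d′ , del-d , refl) = d′ , c , Deletion-All del-d dU , cV ,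
      subst (λ n → length d′ + length c < n + length (c ∷ʳ b)) (sym (Deletion-length del-d))
        (+-mono-<-≤ (n<1+n _) (subst (length c ≤_) (sym (length-∷ʳ c b)) (n≤1+n _))) ,
      shortened d c b d′ c eval-del
    ...   | inj₂ (_ , del-r , refl) with Deletion-++ xs c del-r
    ...     | inj₂ (c′ , del-c , refl) = d , c′ , dU , Deletion-All del-c cV ,
      +-monoʳ-< (length d) (subst (length c′ <_) (sym (trans (length-∷ʳ c b) (cong suc (Deletion-length del-c))))
        (m<n⇒m<1+n (n<1+n _))) ,
      shortened d c b d c′ eval-del
    ...     | inj₁ (xs′ , del-x , refl) =
      contradiction (x-minimal (c ∷ʳ b ++ reverse c) (++⁺ (∷ʳ⁺ cV bV) (All-reverse c cV))) (<⇒≱ (begin-strict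
        ℓ (x ∙ eval (c ∷ʳ b ++ reverse c))   ≡⟨ cong ℓ eval-xs′ ⟨
        ℓ (eval xs′)                         ≤⟨ ℓ≤length xs′ refl ⟩
        length xs′                           <⟨ n<1+n _ ⟩
        suc (length xs′)                     ≡⟨ trans (sym (Deletion-length del-x)) length-xs ⟩
        ℓ x                                  ∎))
      where
      open ≤-Reasoning
      eval-xs′ : eval xs′ ≡ x ∙ eval (c ∷ʳ b ++ reverse c)
      eval-xs′ = ∙-sandwich-cancel (eval d) (eval xs′) x c b (trans (sym (eval-sandwich d xs′ c)) eval-del)

    lengths-add-or-shorten : ∀ {d} → WordOver U d → ℓ (eval d ∙ x) ≡ length d + ℓ x →
      ∀ {c} → Reverse c → WordOver V c → ℓ (eval d ∙ x ∙ eval c) ≡ length d + ℓ x + length c ⊎ Shortening d c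
    lengths-add-or-shorten dU additive [] [] = inj₁ (trans (cong ℓ (identityʳ _)) (trans additive (sym (+-identityʳ _))))
    lengths-add-or-shorten {d} dU additive (c ∶ rc ∶ʳ b) cbV with ∷ʳ⁻ cbV
    ... | cV , bV with lengths-add-or-shorten dU additive rc cV
    ...   | inj₂ (d′ , c′ , d′U , c′V , shorter , eq) = inj₂ (d′ , c′ ∷ʳ b , d′U , ∷ʳ⁺ c′V bV ,
      subst₂ (λ m n → length d′ + m < length d + n) (sym (length-∷ʳ c′ b)) (sym (length-∷ʳ c b))
        (subst₂ _<_ (sym (+-suc _ _)) (sym (+-suc _ _)) (s≤s shorter)) ,
      trans (∙eval-∷ʳ _ c b) (trans (cong (_∙ s b) eq) (sym (∙eval-∷ʳ _ c′ b))))
    ...   | inj₁ additive′ with ℓ-∙s (eval d ∙ x ∙ eval c) b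
    ...     | inj₁ ascent = inj₁ (trans (cong ℓ (∙eval-∷ʳ _ c b)) (trans ascent
      (trans (cong suc additive′) (trans (sym (+-suc _ _)) (cong (length d + ℓ x +_) (sym (length-∷ʳ c b)))))))
    ...     | inj₂ descent = inj₂ (descent-shortens dU cV bV additive′ (≤-trans (n≤1+n _) (≤-reflexive descent)))

  -- The one-sided case U = ⊥, where a shortening would be a shorter word for eval c.
  ℓ-∙-reduced : ∀ {J y} c → RightCosetMinimal J y → WordOver J c → Reduced c → ℓ (y ∙ eval c) ≡ ℓ y + length c
  ℓ-∙-reduced {J} {y} c y-minimal cJ reduced
    with TwoSidedExchange.lengths-add-or-shorten ⊥ J y y-minimal [] (cong ℓ (identityˡ y)) (reverseView c) cJ
  ... | inj₁ additive = trans (cong (λ u → ℓ (u ∙ eval c)) (sym (identityˡ y))) additive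
  ... | inj₂ ((_ ∷ _) , _ , (i∈⊥ ∷ _) , _) = ∀∈-⊥ _ i∈⊥
  ... | inj₂ ([] , c′ , [] , _ , shorter , eq) = contradiction shorter (≤⇒≯ (begin
    length c            ≡⟨ reduced ⟨
    ℓ (eval c)          ≤⟨ ℓ≤length c′ (∙-cancelˡ (e ∙ y) (eval c′) (eval c) (sym eq)) ⟩
    length c′           ∎))
    where open ≤-Reasoning

  ℓ-bound : ∀ w → ℓ w ≤ sum (map ℓ elems)
  ℓ-bound w = go elems (complete w)
    where
    go : ∀ ws → w Mem.∈ ws → ℓ w ≤ sum (map ℓ ws)
    go (v ∷ ws) (here refl) = m≤m+n (ℓ w) _
    go (v ∷ ws) (there w∈ws) = ≤-trans (go ws w∈ws) (m≤n+m _ (ℓ v))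

  LowersBelow : Subset r → ℕ → W → ℕ → Set
  LowersBelow J n y N = ∃ λ c → WordOver J c × length c ≤ n × ℓ (y ∙ eval c) < N

  lowersBelow? : ∀ J n y N → Dec (LowersBelow J n y N)
  lowersBelow? J zero y N = map′
    (λ lt → [] , [] , z≤n , lt)
    (λ { ([] , _ , _ , lt) → lt })
    (ℓ (y ∙ e) <? N)
  lowersBelow? J (suc n) y N = map′
    (λ { (inj₁ lt) → [] , [] , z≤n , lt
       ; (inj₂ (j , j∈J , c , cJ , len≤ , lt)) →
           j ∷ c , j∈J ∷ cJ , s≤s len≤ , subst (λ u → ℓ u < N) (assoc y (s j) (eval c)) lt })
    (λ { ([] , _ , _ , lt) → inj₁ lt
       ; ((j ∷ c) , j∈J ∷ cJ , s≤s len≤ , lt) →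
           inj₂ (j , j∈J , c , cJ , len≤ , subst (λ u → ℓ u < N) (sym (assoc y (s j) (eval c))) lt) })
    ((ℓ (y ∙ e) <? N) ⊎-dec any? (λ j → (j ∈? J) ×-dec lowersBelow? J n (y ∙ s j) N))

  -- Finiteness of W enters here: if some J-word lowers ℓ x then so does a reduced one, and reduced
  -- words are no longer than the sum of all lengths, so the bounded search of lowersBelow? suffices.
  right-coset-minimum : ∀ J x → ∃ λ y → RightCosetMinimal J y × ∃ λ c → WordOver J c × y ≡ x ∙ eval c
  right-coset-minimum J x = go (ℓ x) x ≤-refl
    where
    go : ∀ n x → ℓ x ≤ n → ∃ λ y → RightCosetMinimal J y × ∃ λ c → WordOver J c × y ≡ x ∙ eval c
    go n x ℓx≤n with lowersBelow? J (sum (map ℓ elems)) x (ℓ x)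
    ... | no ¬lowers = x , minimal , [] , [] , sym (identityʳ x)
      where
      minimal : RightCosetMinimal J x
      minimal c cJ with reduce c cJ
      ... | d , dJ , reduced , eval≡ , _ = ≮⇒≥ λ lt → ¬lowers (d , dJ ,
        subst (_≤ sum (map ℓ elems)) reduced (ℓ-bound (eval d)) , subst (λ u → ℓ (x ∙ u) < ℓ x) (sym eval≡) lt)
    go (suc n) x ℓx≤n | yes (c , cJ , _ , lt) with go n (x ∙ eval c) (≤-pred (≤-trans lt ℓx≤n))
    ... | y , minimal , c′ , c′J , y≡ = y , minimal , c ++ c′ , ++⁺ cJ c′J ,
      trans y≡ (trans (assoc x (eval c) (eval c′)) (cong (x ∙_) (sym (eval-++ c c′))))
    go zero x ℓx≤0 | yes (_ , _ , _ , lt) = contradiction (≤-trans lt ℓx≤0) λ ()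

  -- Write x = y ∙ eval d with y minimal in x W_J and d reduced: the last letter of a nonempty d
  -- would be a right descent of x.
  InMinRight⇒RightCosetMinimal : ∀ J x → InMinRight C ℓ J x → RightCosetMinimal J x
  InMinRight⇒RightCosetMinimal J x no-descent with right-coset-minimum J x
  ... | y , y-minimal , c , cJ , y≡x∙c with reduce (reverse c) (All-reverse c cJ)
  ...   | d , dJ , reduced , eval-d , _ = go (reverseView d) dJ reduced x≡y∙d
    where
    x≡y∙d : x ≡ y ∙ eval d
    x≡y∙d = trans (x≈z//y x (eval c) y (sym y≡x∙c)) (cong (y ∙_) (trans (sym (eval-reverse c)) (sym eval-d)))
    go : ∀ {d} → Reverse d → WordOver J d → Reduced d → x ≡ y ∙ eval d → RightCosetMinimal J x
    go [] _ _ x≡y∙e = subst (RightCosetMinimal J) (sym (trans x≡y∙e (identityʳ y))) y-minimal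
    go (d₀ ∶ _ ∶ʳ b) d₀bJ reduced x≡y∙d₀b = contradiction (no-descent b (proj₂ (∷ʳ⁻ d₀bJ))) (<⇒≯ (begin-strict
      ℓ (x ∙ s b)                 ≡⟨ cong (λ u → ℓ (u ∙ s b)) (trans x≡y∙d₀b (∙eval-∷ʳ y d₀ b)) ⟩
      ℓ (y ∙ eval d₀ ∙ s b ∙ s b) ≡⟨ cong ℓ (∙s∙s (y ∙ eval d₀) b) ⟩
      ℓ (y ∙ eval d₀)             ≡⟨ ℓ-∙-reduced d₀ y-minimal (proj₁ (∷ʳ⁻ d₀bJ)) (Reduced-∷ʳ⁻ d₀ b reduced) ⟩
      ℓ y + length d₀             <⟨ +-monoʳ-< (ℓ y) (subst (length d₀ <_) (sym (length-∷ʳ d₀ b)) (n<1+n _)) ⟩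
      ℓ y + length (d₀ ∷ʳ b)      ≡⟨ ℓ-∙-reduced (d₀ ∷ʳ b) y-minimal d₀bJ reduced ⟨
      ℓ (y ∙ eval (d₀ ∷ʳ b))      ≡⟨ cong ℓ (sym x≡y∙d₀b) ⟩
      ℓ x                         ∎))
      where open ≤-Reasoning

  InMinLeft⇒InMinRight⁻¹ : ∀ J x → InMinLeft C ℓ J x → InMinRight C ℓ J (x ⁻¹)
  InMinLeft⇒InMinRight⁻¹ J x no-descent j j∈J = subst₂ _<_ (sym (ℓ-⁻¹ x))
    (trans (sym (ℓ-⁻¹ (s j ∙ x))) (cong ℓ (trans (⁻¹-anti-homo-∙ (s j) x) (cong (x ⁻¹ ∙_) (s⁻¹≡s j)))))
    (no-descent j j∈J)

  ℓ-reduced-∙ : ∀ {J x} d → InMinLeft C ℓ J x → WordOver J d → Reduced d → ℓ (eval d ∙ x) ≡ length d + ℓ x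
  ℓ-reduced-∙ {J} {x} d no-descent dJ reduced = begin
    ℓ (eval d ∙ x)                   ≡⟨ ℓ-⁻¹ (eval d ∙ x) ⟨
    ℓ ((eval d ∙ x) ⁻¹)              ≡⟨ cong ℓ (⁻¹-anti-homo-∙ (eval d) x) ⟩
    ℓ (x ⁻¹ ∙ eval d ⁻¹)             ≡⟨ cong (λ u → ℓ (x ⁻¹ ∙ u)) (eval-reverse d) ⟨
    ℓ (x ⁻¹ ∙ eval (reverse d))      ≡⟨ ℓ-∙-reduced (reverse d) x⁻¹-minimal (All-reverse d dJ) reduced-reverse ⟩
    ℓ (x ⁻¹) + length (reverse d)    ≡⟨ cong₂ _+_ (ℓ-⁻¹ x) (length-reverse d) ⟩
    ℓ x + length d                   ≡⟨ +-comm (ℓ x) (length d) ⟩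
    length d + ℓ x                   ∎
    where
    open ≡-Reasoning
    x⁻¹-minimal : RightCosetMinimal J (x ⁻¹)
    x⁻¹-minimal = InMinRight⇒RightCosetMinimal J (x ⁻¹) (InMinLeft⇒InMinRight⁻¹ J x no-descent)
    reduced-reverse : Reduced (reverse d)
    reduced-reverse = trans (cong ℓ (eval-reverse d)) (trans (ℓ-⁻¹ (eval d)) (trans reduced (sym (length-reverse d))))

  _⊑_ : W → W → Set
  x ⊑ y = ℓ x ≤ ℓ y × (ℓ y ≡ ℓ x → y ≡ x)

  ⊑-trans : ∀ {x y z} → x ⊑ y → y ⊑ z → x ⊑ z
  ⊑-trans {x} {y} (ℓx≤ℓy , y≡x) (ℓy≤ℓz , z≡y) = ≤-trans ℓx≤ℓy ℓy≤ℓz , λ ℓz≡ℓx →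
    let ℓy≡ℓz = ≤-antisym ℓy≤ℓz (subst (_≤ ℓ y) (sym ℓz≡ℓx) ℓx≤ℓy)
    in trans (z≡y (sym ℓy≡ℓz)) (y≡x (trans ℓy≡ℓz ℓz≡ℓx))

  ⊑-tight : ∀ {x y} → x ⊑ y → ℓ y ≤ ℓ x → y ≡ x
  ⊑-tight (ℓx≤ℓy , y≡x) ℓy≤ℓx = y≡x (≤-antisym ℓy≤ℓx ℓx≤ℓy)

  double-coset-minimal : ∀ {U V x a b} → InMinLeft C ℓ U x → InMinRight C ℓ V x →
    InParabolic C U a → InParabolic C V b → x ⊑ (a ∙ x ∙ b)
  double-coset-minimal {U} {V} {x} x-left x-right (d , dU , refl) (c , cV , refl) = go _ d c dU cV ≤-refl
    where
    open TwoSidedExchange U V x (InMinRight⇒RightCosetMinimal V x x-right)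

    additive⇒⊑ : ∀ d c → ℓ (eval d ∙ x ∙ eval c) ≡ length d + ℓ x + length c → x ⊑ (eval d ∙ x ∙ eval c)
    additive⇒⊑ d c additive = subst (ℓ x ≤_) (sym additive) ℓx≤ , only-trivial d c additive
      where
      ℓx≤ : ℓ x ≤ length d + ℓ x + length c
      ℓx≤ = ≤-trans (m≤n+m (ℓ x) (length d)) (m≤m+n _ (length c))
      only-trivial : ∀ d c → ℓ (eval d ∙ x ∙ eval c) ≡ length d + ℓ x + length c →
                     ℓ (eval d ∙ x ∙ eval c) ≡ ℓ x → eval d ∙ x ∙ eval c ≡ x
      only-trivial []      []      _        _  = trans (identityʳ _) (identityˡ x)
      only-trivial []      (_ ∷ c) additive ℓ≡ = contradiction (≤-reflexive (trans (sym additive) ℓ≡)) (m+1+n≰m (ℓ x))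
      only-trivial (_ ∷ d) c       additive ℓ≡ = contradiction (≤-reflexive (trans (sym additive) ℓ≡))
        (≤⇒≯ (≤-trans (m≤n+m (ℓ x) (length d)) (m≤m+n _ (length c))))

    go-below : ∀ n d c → WordOver U d → WordOver V c → length d + length c < n → x ⊑ (eval d ∙ x ∙ eval c)

    go : ∀ n d c → WordOver U d → WordOver V c → length d + length c ≤ n → x ⊑ (eval d ∙ x ∙ eval c)
    go n d c dU cV bound with reduce d dU
    ... | d₁ , d₁U , reduced , eval-d₁ , len≤
      with lengths-add-or-shorten d₁U (ℓ-reduced-∙ d₁ x-left d₁U reduced) (reverseView c) cV
    ...   | inj₁ additive = subst (λ u → x ⊑ (u ∙ x ∙ eval c)) eval-d₁ (additive⇒⊑ d₁ c additive)
    ...   | inj₂ (d′ , c′ , d′U , c′V , shorter , eq) =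
      subst (x ⊑_) (trans (sym eq) (cong (λ u → u ∙ x ∙ eval c) eval-d₁))
        (go-below n d′ c′ d′U c′V (<-≤-trans shorter (≤-trans (+-monoˡ-≤ (length c) len≤) bound)))

    go-below zero    d c dU cV ()
    go-below (suc n) d c dU cV lt = go n d c dU cV (ℕ.s≤s⁻¹ lt)

  double-coset-⊑ : ∀ {U V x y} → InMinLeft C ℓ U x → InMinRight C ℓ V x → SameDoubleCoset U V x y → x ⊑ y
  double-coset-⊑ x-left x-right (_ , _ , aU , bV , refl) = double-coset-minimal x-left x-right aU bV

  double-coset-unique : ∀ {U V x y} → InMinLeft C ℓ U x → InMinRight C ℓ V x → InMinLeft C ℓ U y → InMinRight C ℓ V y →
    SameDoubleCoset U V x y → y ≡ x
  double-coset-unique x-left x-right y-left y-right x∼y = ⊑-tight (double-coset-⊑ x-left x-right x∼y)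
    (proj₁ (double-coset-⊑ y-left y-right (SameDoubleCoset-sym x∼y)))

  InMinRight-transfer : ∀ {U V y z u} → InMinRight C ℓ V y → InMinLeft C ℓ U z → InParabolic C U u → y ≡ u ∙ z →
    InMinRight C ℓ V z
  InMinRight-transfer {z = z} y-right z-left (c , cU , refl) refl v v∈V with reduce c cU
  ... | d , dU , reduced , eval-d , _ = +-cancelˡ-< (length d) (ℓ z) (ℓ (z ∙ s v)) (begin-strict
    length d + ℓ z              ≡⟨ ℓ-reduced-∙ d z-left dU reduced ⟨
    ℓ (eval d ∙ z)              ≡⟨ cong (λ u → ℓ (u ∙ z)) eval-d ⟩
    ℓ (eval c ∙ z)              <⟨ y-right v v∈V ⟩
    ℓ (eval c ∙ z ∙ s v)        ≡⟨ cong (λ u → ℓ (u ∙ z ∙ s v)) (sym eval-d) ⟩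
    ℓ (eval d ∙ z ∙ s v)        ≡⟨ cong ℓ (assoc _ _ _) ⟩
    ℓ (eval d ∙ (z ∙ s v))      ≤⟨ ℓ-∙ (eval d) (z ∙ s v) ⟩
    ℓ (eval d) + ℓ (z ∙ s v)    ≡⟨ cong (_+ ℓ (z ∙ s v)) reduced ⟩
    length d + ℓ (z ∙ s v)      ∎)
    where open ≤-Reasoning

module Idempotents (C : FiniteCoxeterSystem) (ℓ : FiniteCoxeterSystem.W C → ℕ) (isℓ : IsLengthFunction C ℓ)
  (P Q : Subset (FiniteCoxeterSystem.r C) → FiniteCoxeterSystem.W C → FiniteCoxeterSystem.W C)
  (isP : IsP C ℓ P) (isQ : IsQ C ℓ Q) where

  open Cosets C ℓ isℓ

  P-right : ∀ J w → InMinRight C ℓ J (P J w)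
  P-right J w = proj₁ (isP J w)

  Q-left : ∀ I w → InMinLeft C ℓ I (Q I w)
  Q-left I w = proj₁ (isQ I w)

  P-coset : ∀ J w → SameDoubleCoset ⊥ J w (P J w)
  P-coset J w with isP J w
  ... | _ , u , uJ , w≡ = e , u ⁻¹ , InParabolic-e , InParabolic-⁻¹ uJ ,
    trans (x≈z//y (P J w) u w (sym w≡)) (cong (_∙ u ⁻¹) (sym (identityˡ w)))

  Q-coset : ∀ I w → SameDoubleCoset I ⊥ w (Q I w)
  Q-coset I w with isQ I w
  ... | _ , u , uI , w≡ = u ⁻¹ , e , InParabolic-⁻¹ uI , InParabolic-e ,
    trans (y≈x\\z u (Q I w) w (sym w≡)) (sym (identityʳ _))

  P-⊑ : ∀ J w → P J w ⊑ w
  P-⊑ J w = double-coset-⊑ ∀∈-⊥ (P-right J w) (SameDoubleCoset-sym (P-coset J w))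

  Q-⊑ : ∀ I w → Q I w ⊑ w
  Q-⊑ I w = double-coset-⊑ (Q-left I w) ∀∈-⊥ (SameDoubleCoset-sym (Q-coset I w))

  P-fixes : ∀ J w → InMinRight C ℓ J w → P J w ≡ w
  P-fixes J w w-right = double-coset-unique ∀∈-⊥ w-right ∀∈-⊥ (P-right J w) (P-coset J w)

  Q-fixes : ∀ I w → InMinLeft C ℓ I w → Q I w ≡ w
  Q-fixes I w w-left = double-coset-unique w-left ∀∈-⊥ (Q-left I w) ∀∈-⊥ (Q-coset I w)

  QP-right : ∀ I J w → InMinRight C ℓ J (Q I (P J w))
  QP-right I J w with isQ I (P J w)
  ... | _ , u , uI , Pw≡ = InMinRight-transfer (P-right J w) (Q-left I (P J w)) uI Pw≡

  QP-coset : ∀ I J w → SameDoubleCoset I J w (Q I (P J w))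
  QP-coset I J w = SameDoubleCoset-trans (SameDoubleCoset-⊆ ⊥⊆ ⊆-refl (P-coset J w))
                                         (SameDoubleCoset-⊆ ⊆-refl ⊥⊆ (Q-coset I (P J w)))

  QP-idempotent : ∀ I J w → Q I (P J (Q I (P J w))) ≡ Q I (P J w)
  QP-idempotent I J w = trans (cong (Q I) (P-fixes J _ (QP-right I J w))) (Q-fixes I _ (Q-left I (P J w)))

  compose : List (Subset r × Subset r) → W → W
  compose = composeQP P Q

  compose-coset : ∀ gs w → SameDoubleCoset (leftUnion gs) (rightUnion gs) w (compose gs w)
  compose-coset []             w = e , e , InParabolic-e , InParabolic-e , solve monoid
  compose-coset ((I , J) ∷ gs) w = SameDoubleCoset-trans
    (SameDoubleCoset-⊆ (q⊆p∪q I _) (q⊆p∪q J _) (compose-coset gs w))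
    (SameDoubleCoset-⊆ (p⊆p∪q _) (p⊆p∪q _) (QP-coset I J (compose gs w)))

  compose-⊑ : ∀ gs w → compose gs w ⊑ w
  compose-⊑ []             w = ≤-refl , λ _ → refl
  compose-⊑ ((I , J) ∷ gs) w = ⊑-trans (Q-⊑ I _) (⊑-trans (P-⊑ J _) (compose-⊑ gs w))

  -- No factor increases length, so a fixed point of the composite is fixed by every factor.
  fixed-by-compose : ∀ gs x → compose gs x ≡ x →
                     InMinLeft C ℓ (leftUnion gs) x × InMinRight C ℓ (rightUnion gs) x
  fixed-by-compose []             x _    = ∀∈-⊥ , ∀∈-⊥
  fixed-by-compose ((I , J) ∷ gs) x fixed = ∀∈-∪ x-left (proj₁ tail-fixed) , ∀∈-∪ x-right (proj₂ tail-fixed)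
    where
    fixed-tail : compose gs x ≡ x
    fixed-tail = sym (⊑-tight (compose-⊑ gs x)
      (subst (λ u → ℓ u ≤ ℓ (compose gs x)) fixed (proj₁ (⊑-trans (Q-⊑ I _) (P-⊑ J _)))))
    tail-fixed : InMinLeft C ℓ (leftUnion gs) x × InMinRight C ℓ (rightUnion gs) x
    tail-fixed = fixed-by-compose gs x fixed-tail
    QPx≡x : Q I (P J x) ≡ x
    QPx≡x = trans (cong (λ u → Q I (P J u)) (sym fixed-tail)) fixed
    Px≡x : P J x ≡ x
    Px≡x = sym (⊑-tight (P-⊑ J x) (subst (λ u → ℓ u ≤ ℓ (P J x)) QPx≡x (proj₁ (Q-⊑ I (P J x)))))
    x-right : InMinRight C ℓ J x
    x-right = subst (InMinRight C ℓ J) Px≡x (P-right J x)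
    x-left : InMinLeft C ℓ I x
    x-left = subst (InMinLeft C ℓ I) QPx≡x (Q-left I (P J x))

  idempotent⇒QP : ∀ gs → (∀ w → compose gs (compose gs w) ≡ compose gs w) →
                  ∃₂ λ I J → ∀ w → compose gs w ≡ Q I (P J w)
  idempotent⇒QP gs idempotent = leftUnion gs , rightUnion gs , λ w →
    let x-left , x-right = fixed-by-compose gs (compose gs w) (idempotent w)
    in double-coset-unique (Q-left _ (P _ w)) (QP-right _ _ w) x-left x-right
         (SameDoubleCoset-trans (SameDoubleCoset-sym (QP-coset _ _ w)) (compose-coset gs w))

  QP⇒idempotent : ∀ gs → (∃₂ λ I J → ∀ w → compose gs w ≡ Q I (P J w)) →
                  ∀ w → compose gs (compose gs w) ≡ compose gs w
  QP⇒idempotent gs (I , J , compose≡QP) w = begin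
    compose gs (compose gs w)        ≡⟨ compose≡QP (compose gs w) ⟩
    Q I (P J (compose gs w))         ≡⟨ cong (Q I ∘ P J) (compose≡QP w) ⟩
    Q I (P J (Q I (P J w)))          ≡⟨ QP-idempotent I J w ⟩
    Q I (P J w)                      ≡⟨ compose≡QP w ⟨
    compose gs w                     ∎
    where open ≡-Reasoning

lemma4p14 : (C : FiniteCoxeterSystem) (ℓ : FiniteCoxeterSystem.W C → ℕ) → IsLengthFunction C ℓ →
    (P Q : Subset (FiniteCoxeterSystem.r C) → FiniteCoxeterSystem.W C → FiniteCoxeterSystem.W C) →
    IsP C ℓ P → IsQ C ℓ Q →
    (gs : List (Subset (FiniteCoxeterSystem.r C) × Subset (FiniteCoxeterSystem.r C))) →
    (∀ w → composeQP P Q gs (composeQP P Q gs w) ≡ composeQP P Q gs w)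
      ⇔ (∃₂ λ I J → ∀ w → composeQP P Q gs w ≡ Q I (P J w))
lemma4p14 C ℓ isℓ P Q isP isQ gs = mk⇔ (idempotent⇒QP gs) (QP⇒idempotent gs)
  where open Idempotents C ℓ isℓ P Q isP isQ
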